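{- If $G$ is a connected graph of order $n\ge 2$, then $1\le \kappa(G)\le n-1$. Moreover, $\kappa(G)=n-1$ if and only if $G$ has a vertex of degree $n-1$.
   Context: Graphs are finite, simple, connected; $d_G$ is the shortest-path distance. For $S\subseteq V(G)$ and $x\in V(G)$, $m(x|S)$ is the multiset $\{\!\{d_G(x,s): s\in S\}\!\}$. A nonempty set $S\subsetneq V(G)$ is a $k$-multiset antiresolving set ($k$-MARS) if $k$ equals the minimum size of an equivalence class of the relation on $V(G)\setminus S$ given by $x\sim y \iff m(x|S)=m(y|S)$. $\kappa(G)$ denotes the largest integer $k$ such that $G$ contains a $k$-MARS. -}

module Defs where

open import Data.Nat using (ℕ; zero; suc; _≤_; _∸_)
open import Data.Bool using (Bool; true; false; _∧_; _∨_; not; if_then_else_)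
open import Data.Fin using (Fin; _≟_)
open import Data.List using (List; map; length; allFin; filterᵇ)
open import Data.Bool.ListAction using (any)
open import Data.List.Membership.Propositional using (_∈_)
open import Data.List.Relation.Unary.Unique.Propositional using (Unique)
open import Data.List.Relation.Binary.Permutation.Propositional using (_↭_)
open import Data.Product using (Σ; ∃; _×_)
open import Relation.Nullary using (does)
open import Relation.Binary.PropositionalEquality using (_≡_)
open import Function.Bundles using (_⇔_)

record Graph (n : ℕ) : Set where
  field
    adj    : Fin n → Fin n → Bool
    sym    : ∀ x y → adj x y ≡ adj y x
    irrefl : ∀ x → adj x x ≡ false
open Graph public

module _ {n : ℕ} (G : Graph n) where

  -- reach k x y = true  iff  there is a walk of length ≤ k from x to y
  reach : ℕ → Fin n → Fin n → Bool
  reach zero    x y = does (x ≟ y)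
  reach (suc k) x y = reach k x y ∨ any (λ z → adj G x z ∧ reach k z y) (allFin n)

  Connected : Set
  Connected = ∀ x y → ∃ λ k → reach k x y ≡ true

  distFrom : ℕ → ℕ → Fin n → Fin n → ℕ
  distFrom i zero       x y = i
  distFrom i (suc fuel) x y = if reach i x y then i else distFrom (suc i) fuel x y

  -- shortest-path distance d_G(x,y) (correct for connected G, where d ≤ n - 1)
  dist : Fin n → Fin n → ℕ
  dist x y = distFrom 0 n x y

  degree : Fin n → ℕ
  degree v = length (filterᵇ (adj G v) (allFin n))

  Subset : Set
  Subset = Fin n → Bool

  -- m(x|S) as a list, compared up to permutation (multiset equality)
  mset : Fin n → Subset → List ℕ
  mset x S = map (dist x) (filterᵇ S (allFin n))

  Equiv : Subset → Fin n → Fin n → Set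
  Equiv S x y = (S x ≡ false) × (S y ≡ false) × (mset x S ↭ mset y S)

  ClassSize : Subset → Fin n → ℕ → Set
  ClassSize S x c = Σ (List (Fin n)) λ L →
    Unique L × (∀ y → (y ∈ L) ⇔ Equiv S x y) × (length L ≡ c)

  IsMARS : Subset → ℕ → Set
  IsMARS S k =
    (∃ λ s → S s ≡ true) ×
    (∃ λ v → S v ≡ false) ×
    (∃ λ x → S x ≡ false × ClassSize S x k) ×
    (∀ x c → S x ≡ false → ClassSize S x c → k ≤ c)

  IsKappa : ℕ → Set
  IsKappa k = (∃ λ S → IsMARS S k) × (∀ S k′ → IsMARS S k′ → k′ ≤ k)

{-# OPTIONS --safe #-}
-- Every class of a MARS S omits the vertices of S and contains its own
-- representative, so every k-MARS has 1 ≤ k ≤ n - 1.  The least class size is a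
-- function of S, so it has a maximum over the finitely many proper subsets:
-- this is κ(G).  If v has degree n - 1, all other vertices are at distance 1
-- from v, so {v} is an (n - 1)-MARS.  Conversely, a class of size n - 1 of an
-- (n - 1)-MARS S contains every vertex except one vertex s ∈ S; hence S = {s}
-- and all other vertices are equidistant from s.  Since s has a neighbour,
-- that common distance is 1, so s has degree n - 1.
module Submission where

open import Defs hiding (sym)
open import Data.Bool using (Bool; true; false; T; not; if_then_else_)
import Data.Bool as Bool
open import Data.Bool.ListAction using (any)
open import Data.Bool.Properties using (T?; T-≡; T-not-≡; T-∧; T-∨)
open import Data.Empty using (⊥-elim)
open import Data.Fin using (Fin; zero; suc; fromℕ<) renaming (_≟_ to _≟ᶠ_)
open import Data.Fin.Properties using (nonZeroIndex)
open import Data.List using (List; []; _∷_; map; length; allFin; filter; filterᵇ; null)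
open import Data.List.Extrema.Nat using (min; min≤⊤; min≤xs; argmin-sel)
open import Data.List.Membership.Propositional using (_∈_; _∉_; find; lose)
open import Data.List.Membership.Propositional.Properties
  using (∈-allFin; ∈-length; ∈-filter⁺; ∈-filter⁻; ∈-map⁺; ∈-map⁻)
open import Data.List.Properties
  using (filter-notAll; filter-≐; length-tabulate; map-cong; map-cong-local; ≡-dec)
open import Data.List.Relation.Binary.Permutation.Propositional
  using (_↭_; ↭-refl; ↭-trans; ↭-sym; ↭-reflexive; ↭⇒↭ₛ)
open import Data.List.Relation.Binary.Permutation.Propositional.Properties using (∈-resp-↭)
open import Data.List.Relation.Binary.Pointwise using (Pointwise-≡⇒≡)
open import Data.List.Relation.Binary.Subset.Propositional using (_⊆_)
open import Data.List.Relation.Unary.All as All using (All)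
open import Data.List.Relation.Unary.All.Properties using (¬Any⇒All¬)
open import Data.List.Relation.Unary.AllPairs using ([]; _∷_)
open import Data.List.Relation.Unary.Any as Any using (Any; here; there)
open import Data.List.Relation.Unary.Any.Properties using (any⁺; any⁻)
open import Data.List.Relation.Unary.Sorted.TotalOrder.Properties using (↗↭↗⇒≋)
open import Data.List.Relation.Unary.Unique.Propositional using (Unique)
open import Data.List.Relation.Unary.Unique.Propositional.Properties using (allFin⁺; filter⁺)
open import Data.Nat using (ℕ; zero; suc; _≤_; _∸_; _⊔_; z≤n; s≤s; NonZero)
open import Data.Nat.Properties
  using (≤-refl; ≤-trans; ≤-antisym; ≤-reflexive; n≤1+n; 1+n≰n; suc-injective; ∸-monoˡ-≤;
         ⊔-sel; m≤m⊔n; m≤n⊔m; ≤-decTotalOrder; ≤-totalOrder)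
  renaming (_≟_ to _≟ⁿ_)
open import Data.List.Sort ≤-decTotalOrder using (sort; sort-↭; sort-↗)
open import Data.Product using (∃; _×_; _,_; proj₁; proj₂)
open import Data.Sum using (inj₁; inj₂; [_,_]′)
open import Data.Vec.Functional using (Vector; head; tail) renaming (_∷_ to _∷ᵥ_)
open import Function using (_∘_; id)
open import Function.Bundles using (_⇔_; mk⇔; Equivalence)
open import Function.Construct.Symmetry using (⇔-sym)
open import Function.Properties.Equivalence using () renaming (trans to ⇔-trans)
open import Level using (0ℓ)
open import Relation.Binary.Definitions using (DecidableEquality; Decidable)
open import Relation.Binary.PropositionalEquality
  using (_≡_; _≢_; _≗_; refl; sym; trans; cong; cong₂; subst; subst₂)
open import Relation.Nullary using (¬_; yes; no; does; contradiction)
open import Relation.Nullary.Decidable using (dec-true; dec-false; map′; _×-dec_; ¬?)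
open import Relation.Unary using (Pred) renaming (Decidable to Decidable₁)

module _ {A : Set} (_≟_ : DecidableEquality A) where

  unique-⊆⇒length≤ : {xs ys : List A} → Unique xs → xs ⊆ ys → length xs ≤ length ys
  unique-⊆⇒length≤ {[]} _ _ = z≤n
  unique-⊆⇒length≤ {x ∷ xs} {ys} (x∉xs ∷ xs!) xs⊆ys =
    ≤-trans (s≤s (unique-⊆⇒length≤ xs! xs⊆ys-x)) (filter-notAll (¬? ∘ (_≟ x)) ys x∈ys)
    where
    xs⊆ys-x : xs ⊆ filter (¬? ∘ (_≟ x)) ys
    xs⊆ys-x y∈xs =
      ∈-filter⁺ (¬? ∘ (_≟ x)) (xs⊆ys (there y∈xs)) (All.lookup x∉xs y∈xs ∘ sym)

    x∈ys : Any (λ y → ¬ ¬ y ≡ x) ys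
    x∈ys = Any.map (λ x≡y y≢x → y≢x (sym x≡y)) (xs⊆ys (here refl))

  unique-≈⇒length≡ : {xs ys : List A} → Unique xs → Unique ys →
                     (∀ z → z ∈ xs ⇔ z ∈ ys) → length xs ≡ length ys
  unique-≈⇒length≡ xs! ys! xs≈ys = ≤-antisym
    (unique-⊆⇒length≤ xs! (Equivalence.to (xs≈ys _)))
    (unique-⊆⇒length≤ ys! (Equivalence.from (xs≈ys _)))

module _ {A : Set} (f : A → ℕ) where

  minOn : List A → ℕ
  minOn []       = 0
  minOn (x ∷ xs) = min (f x) (map f xs)

  minOn-≤ : ∀ {x xs} → x ∈ xs → minOn xs ≤ f x
  minOn-≤ {xs = x ∷ xs} (here refl) = min≤⊤ (f x) (map f xs)
  minOn-≤ {xs = y ∷ xs} (there x∈xs) = All.lookup (min≤xs (f y) (map f xs)) (∈-map⁺ f x∈xs)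

  minOn-attained : ∀ {x xs} → x ∈ xs → ∃ λ y → y ∈ xs × minOn xs ≡ f y
  minOn-attained {xs = y ∷ xs} _ with argmin-sel id (f y) (map f xs)
  ... | inj₁ eq = y , here refl , eq
  ... | inj₂ m∈ = let (z , z∈xs , eq) = ∈-map⁻ f m∈ in z , there z∈xs , eq

  minOn-pos⇒nonempty : ∀ {xs} → 1 ≤ minOn xs → ∃ λ x → x ∈ xs
  minOn-pos⇒nonempty {x ∷ _} _ = x , here refl

minOn-cong : {A : Set} {f g : A → ℕ} → f ≗ g → minOn f ≗ minOn g
minOn-cong f≗g []       = refl
minOn-cong f≗g (x ∷ xs) = cong₂ min (f≗g x) (map-cong f≗g xs)

∈⇒null≡false : {A : Set} {x : A} {xs : List A} → x ∈ xs → null xs ≡ false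
∈⇒null≡false (here _)  = refl
∈⇒null≡false (there _) = refl

if-null-pos : {A : Set} (xs : List A) {m : ℕ} → 1 ≤ (if null xs then 0 else m) →
              ∃ λ x → x ∈ xs × 1 ≤ m
if-null-pos (x ∷ _) pos = x , here refl , pos

filterᵇ-cong : {A : Set} {p q : A → Bool} → p ≗ q → filterᵇ p ≗ filterᵇ q
filterᵇ-cong {p = p} {q} p≗q =
  filter-≐ (T? ∘ p) (T? ∘ q) ((λ {x} → subst T (p≗q x)) , (λ {x} → subst T (sym (p≗q x))))

↭-dec : Decidable (_↭_ {A = ℕ})
↭-dec xs ys = map′ sort≡⇒↭ ↭⇒sort≡ (≡-dec _≟ⁿ_ (sort xs) (sort ys))
  where
  sort≡⇒↭ : sort xs ≡ sort ys → xs ↭ ys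
  sort≡⇒↭ eq = ↭-trans (↭-sym (sort-↭ xs)) (subst (_↭ ys) (sym eq) (sort-↭ ys))

  ↭⇒sort≡ : xs ↭ ys → sort xs ≡ sort ys
  ↭⇒sort≡ p = Pointwise-≡⇒≡ (↗↭↗⇒≋ ≤-totalOrder (sort-↗ xs) (sort-↗ ys)
    (↭⇒↭ₛ (↭-trans (sort-↭ xs) (↭-trans p (↭-sym (sort-↭ ys))))))

-- Subsets are Boolean functions and there is no function extensionality,
-- so F has to respect pointwise equality.
max-attained : ∀ m (F : Vector Bool m → ℕ) → (∀ {S T} → S ≗ T → F S ≡ F T) →
               ∃ λ S → ∀ T → F T ≤ F S
max-attained zero    F F-cong = (λ ()) , λ T → ≤-reflexive (F-cong λ ())
max-attained (suc m) F F-cong = [ winner false , winner true ]′ (⊔-sel (best false) (best true))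
  where
  ∷-cong : ∀ b {S T : Vector Bool m} → S ≗ T → (b ∷ᵥ S) ≗ (b ∷ᵥ T)
  ∷-cong b S≗T zero    = refl
  ∷-cong b S≗T (suc i) = S≗T i

  maximal : ∀ b → ∃ λ S → ∀ T → F (b ∷ᵥ T) ≤ F (b ∷ᵥ S)
  maximal b = max-attained m (F ∘ (b ∷ᵥ_)) (F-cong ∘ ∷-cong b)

  best : Bool → ℕ
  best b = F (b ∷ᵥ proj₁ (maximal b))

  head∷tail : (T : Vector Bool (suc m)) → (head T ∷ᵥ tail T) ≗ T
  head∷tail T zero    = refl
  head∷tail T (suc i) = refl

  F≤⊔ : ∀ T → F T ≤ best false ⊔ best true
  F≤⊔ T = subst (_≤ best false ⊔ best true) (F-cong (head∷tail T)) (by-head (head T))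
    where
    by-head : ∀ b → F (b ∷ᵥ tail T) ≤ best false ⊔ best true
    by-head false = ≤-trans (proj₂ (maximal false) (tail T)) (m≤m⊔n _ _)
    by-head true  = ≤-trans (proj₂ (maximal true) (tail T)) (m≤n⊔m _ _)

  winner : ∀ b → best false ⊔ best true ≡ best b → ∃ λ S → ∀ T → F T ≤ F S
  winner b eq = b ∷ᵥ proj₁ (maximal b) , λ T → subst (F T ≤_) eq (F≤⊔ T)

module _ {n : ℕ} where
  open import Data.List.Membership.DecPropositional (_≟ᶠ_ {n}) using (_∈?_)

  length-allFin : length (allFin n) ≡ n
  length-allFin = length-tabulate id

  unique⇒length≤n : {xs : List (Fin n)} → Unique xs → length xs ≤ n
  unique⇒length≤n {xs} xs! =
    subst (length xs ≤_) length-allFin (unique-⊆⇒length≤ _≟ᶠ_ xs! (λ {x} _ → ∈-allFin x))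

  ∈-filter-allFin : {P : Pred (Fin n) 0ℓ} (P? : Decidable₁ P) {x : Fin n} →
                    x ∈ filter P? (allFin n) ⇔ P x
  ∈-filter-allFin P? =
    mk⇔ (proj₂ ∘ ∈-filter⁻ P? {xs = allFin n}) (∈-filter⁺ P? (∈-allFin _))

  covers-all-but⇔length : {v : Fin n} {xs : List (Fin n)} → Unique xs → v ∉ xs →
                          (∀ y → y ≢ v → y ∈ xs) ⇔ suc (length xs) ≡ n
  covers-all-but⇔length {v} {xs} xs! v∉xs = mk⇔ covers⇒length length⇒covers
    where
    v∷xs! : Unique (v ∷ xs)
    v∷xs! = ¬Any⇒All¬ xs v∉xs ∷ xs!

    covers⇒length : (∀ y → y ≢ v → y ∈ xs) → suc (length xs) ≡ n
    covers⇒length covers = ≤-antisym (unique⇒length≤n v∷xs!)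
      (subst (_≤ suc (length xs)) length-allFin
        (unique-⊆⇒length≤ _≟ᶠ_ (allFin⁺ n) allFin⊆v∷xs))
      where
      allFin⊆v∷xs : allFin n ⊆ v ∷ xs
      allFin⊆v∷xs {y} _ with y ≟ᶠ v
      ... | yes y≡v = here y≡v
      ... | no  y≢v = there (covers y y≢v)

    length⇒covers : suc (length xs) ≡ n → ∀ y → y ≢ v → y ∈ xs
    length⇒covers len y y≢v with y ∈? xs
    ... | yes y∈xs = y∈xs
    ... | no  y∉xs =
      ⊥-elim (1+n≰n (subst (λ k → suc k ≤ n) len (unique⇒length≤n y∷v∷xs!)))
      where
      y∷v∷xs! : Unique (y ∷ v ∷ xs)
      y∷v∷xs! = ¬Any⇒All¬ (v ∷ xs) (λ { (here y≡v) → y≢v y≡v ; (there y∈xs) → y∉xs y∈xs })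
                ∷ v∷xs!

another : ∀ {n} → 2 ≤ n → (v : Fin n) → ∃ λ w → w ≢ v
another (s≤s (s≤s _)) zero    = suc zero , λ ()
another (s≤s (s≤s _)) (suc _) = zero , λ ()

suc≡⇔≡∸1 : ∀ {k n} .{{_ : NonZero n}} → suc k ≡ n ⇔ k ≡ n ∸ 1
suc≡⇔≡∸1 {n = suc _} = mk⇔ suc-injective (cong suc)

module _ {n : ℕ} (G : Graph n) where

  Proper : Subset G → Set
  Proper S = (∃ λ s → S s ≡ true) × (∃ λ v → S v ≡ false)

  inside outside : Subset G → List (Fin n)
  inside  S = filterᵇ S (allFin n)
  outside S = filterᵇ (not ∘ S) (allFin n)

  ∈-inside : {S : Subset G} {x : Fin n} → x ∈ inside S ⇔ S x ≡ true
  ∈-inside {S} = ⇔-trans (∈-filter-allFin (T? ∘ S)) T-≡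

  ∈-outside : {S : Subset G} {x : Fin n} → x ∈ outside S ⇔ S x ≡ false
  ∈-outside {S} = ⇔-trans (∈-filter-allFin (T? ∘ not ∘ S)) T-not-≡

  inside-unique : ∀ S → Unique (inside S)
  inside-unique S = filter⁺ {P = T ∘ S} (T? ∘ S) (allFin⁺ n)

  Equiv? : (S : Subset G) (x : Fin n) → Decidable₁ (Equiv G S x)
  Equiv? S x y = (S x Bool.≟ false) ×-dec (S y Bool.≟ false) ×-dec ↭-dec (mset G x S) (mset G y S)

  class : Subset G → Fin n → List (Fin n)
  class S x = filter (Equiv? S x) (allFin n)

  classSize : Subset G → Fin n → ℕ
  classSize S x = length (class S x)

  ∈-class : {S : Subset G} {x y : Fin n} → y ∈ class S x ⇔ Equiv G S x y
  ∈-class {S} {x} = ∈-filter-allFin {P = Equiv G S x} (Equiv? S x)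

  class-unique : ∀ S x → Unique (class S x)
  class-unique S x = filter⁺ {P = Equiv G S x} (Equiv? S x) (allFin⁺ n)

  class-ClassSize : ∀ S x → ClassSize G S x (classSize S x)
  class-ClassSize S x = class S x , class-unique S x , (λ _ → ∈-class {S} {x}) , refl

  ClassSize⇒≡classSize : ∀ {S x c} → ClassSize G S x c → c ≡ classSize S x
  ClassSize⇒≡classSize {S} {x} (L , L! , ∈L⇔ , refl) =
    unique-≈⇒length≡ _≟ᶠ_ L! (class-unique S x)
      (λ y → ⇔-trans (∈L⇔ y) (⇔-sym (∈-class {S} {x})))

  inside∉class : ∀ {S x s L} → S s ≡ true → (∀ y → y ∈ L ⇔ Equiv G S x y) → s ∉ L
  inside∉class Ss ∈L⇔ s∈L =
    contradiction (trans (sym Ss) (proj₁ (proj₂ (Equivalence.to (∈L⇔ _) s∈L)))) λ ()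

  IsMARS-unique : ∀ {S k k′} → IsMARS G S k → IsMARS G S k′ → k ≡ k′
  IsMARS-unique (_ , _ , (x , Sx , x-k) , k-min) (_ , _ , (x′ , Sx′ , x′-k′) , k′-min) =
    ≤-antisym (k-min x′ _ Sx′ x′-k′) (k′-min x _ Sx x-k)

  IsMARS⇒1≤ : ∀ {S k} → IsMARS G S k → 1 ≤ k
  IsMARS⇒1≤ (_ , _ , (x , Sx , (L , _ , ∈L⇔ , refl)) , _) =
    ∈-length (Equivalence.from (∈L⇔ x) (Sx , Sx , ↭-refl))

  IsMARS⇒≤n∸1 : ∀ {S k} → IsMARS G S k → k ≤ n ∸ 1
  IsMARS⇒≤n∸1 ((s , Ss) , _ , (x , _ , (L , L! , ∈L⇔ , refl)) , _) =
    ∸-monoˡ-≤ 1 (unique⇒length≤n (¬Any⇒All¬ L (inside∉class Ss ∈L⇔) ∷ L!))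

  IsKappa⇒bounds : ∀ {k} → IsKappa G k → 1 ≤ k × k ≤ n ∸ 1
  IsKappa⇒bounds ((S , mars) , _) = IsMARS⇒1≤ mars , IsMARS⇒≤n∸1 mars

  Equiv-cong : ∀ {S S′ x y} → S ≗ S′ → Equiv G S x y → Equiv G S′ x y
  Equiv-cong {S} {S′} S≗S′ (Sx , Sy , x↭y) =
    trans (sym (S≗S′ _)) Sx , trans (sym (S≗S′ _)) Sy ,
    subst₂ _↭_ (mset-cong _) (mset-cong _) x↭y
    where
    mset-cong : ∀ z → mset G z S ≡ mset G z S′
    mset-cong z = cong (map (dist G z)) (filterᵇ-cong S≗S′ (allFin n))

  classSize-cong : ∀ {S S′} → S ≗ S′ → classSize S ≗ classSize S′
  classSize-cong {S} {S′} S≗S′ x = cong length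
    (filter-≐ {P = Equiv G S x} {Q = Equiv G S′ x} (Equiv? S x) (Equiv? S′ x)
       (Equiv-cong S≗S′ , Equiv-cong (sym ∘ S≗S′)) (allFin n))

  -- 0 when S is empty or S = V(G), so that a subset of maximal score is a MARS.
  score : Subset G → ℕ
  score S = if null (inside S) then 0 else minOn (classSize S) (outside S)

  score-cong : ∀ {S S′} → S ≗ S′ → score S ≡ score S′
  score-cong {S} {S′} S≗S′ = cong₂ (λ I m → if null I then 0 else m)
    (filterᵇ-cong S≗S′ (allFin n))
    (trans (minOn-cong (classSize-cong S≗S′) (outside S))
           (cong (minOn (classSize S′)) (filterᵇ-cong (cong not ∘ S≗S′) (allFin n))))

  Proper⇒IsMARS-score : ∀ {S} → Proper S → IsMARS G S (score S)
  Proper⇒IsMARS-score {S} (nonempty@(s , Ss) , proper@(v , Sv)) =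
    nonempty , proper , (y , Equivalence.to (∈-outside {S}) y∈ , y-score) , minimal
    where
    least : ∃ λ y → y ∈ outside S × minOn (classSize S) (outside S) ≡ classSize S y
    least = minOn-attained (classSize S) (Equivalence.from (∈-outside {S}) Sv)

    y : Fin n
    y = proj₁ least

    y∈ : y ∈ outside S
    y∈ = proj₁ (proj₂ least)

    score≡minOn : score S ≡ minOn (classSize S) (outside S)
    score≡minOn = cong (λ b → if b then 0 else minOn (classSize S) (outside S))
      (∈⇒null≡false (Equivalence.from (∈-inside {S}) Ss))

    y-score : ClassSize G S y (score S)
    y-score = subst (ClassSize G S y) (sym (trans score≡minOn (proj₂ (proj₂ least))))
      (class-ClassSize S y)

    minimal : ∀ x c → S x ≡ false → ClassSize G S x c → score S ≤ c
    minimal x c Sx x-c = subst₂ _≤_ (sym score≡minOn) (sym (ClassSize⇒≡classSize {S} {x} x-c))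
      (minOn-≤ (classSize S) (Equivalence.from (∈-outside {S}) Sx))

  IsMARS⇒≡score : ∀ {S k} → IsMARS G S k → k ≡ score S
  IsMARS⇒≡score mars@(nonempty , proper , _) =
    IsMARS-unique mars (Proper⇒IsMARS-score (nonempty , proper))

  score-pos⇒Proper : ∀ {S} → 1 ≤ score S → Proper S
  score-pos⇒Proper {S} pos =
    let x , x∈ , pos′ = if-null-pos (inside S) pos
        y , y∈ = minOn-pos⇒nonempty (classSize S) pos′
    in (x , Equivalence.to (∈-inside {S}) x∈) , (y , Equivalence.to (∈-outside {S}) y∈)

  κ-exists : ∀ {S₀} → Proper S₀ → ∃ λ κ → IsKappa G κ
  κ-exists {S₀} proper₀ =
    score S* , (S* , Proper⇒IsMARS-score {S*} proper*) ,
    λ S k mars → subst (_≤ score S*) (sym (IsMARS⇒≡score {S} {k} mars)) (S*-max S)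
    where
    maximum : ∃ λ S → ∀ T → score T ≤ score S
    maximum = max-attained n score (λ {S} {S′} → score-cong {S} {S′})

    S* : Subset G
    S* = proj₁ maximum

    S*-max : ∀ T → score T ≤ score S*
    S*-max = proj₂ maximum

    proper* : Proper S*
    proper* = score-pos⇒Proper {S*}
      (≤-trans (IsMARS⇒1≤ {S₀} (Proper⇒IsMARS-score {S₀} proper₀)) (S*-max S₀))

  distFrom-≥ : ∀ i fuel {x y} → i ≤ distFrom G i fuel x y
  distFrom-≥ i zero = ≤-refl
  distFrom-≥ i (suc fuel) {x} {y} with reach G i x y
  ... | true  = ≤-refl
  ... | false = ≤-trans (n≤1+n i) (distFrom-≥ (suc i) fuel)

  distFrom≡⇔reach : ∀ i fuel {x y} → distFrom G i (suc fuel) x y ≡ i ⇔ reach G i x y ≡ true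
  distFrom≡⇔reach i fuel {x} {y} with reach G i x y
  ... | true  = mk⇔ (λ _ → refl) (λ _ → refl)
  ... | false = mk⇔ (λ eq → ⊥-elim (1+n≰n (subst (suc i ≤_) eq (distFrom-≥ (suc i) fuel)))) λ ()

  distFrom-skip : ∀ i fuel {x y} → reach G i x y ≡ false →
                  distFrom G i (suc fuel) x y ≡ distFrom G (suc i) fuel x y
  distFrom-skip i fuel r rewrite r = refl

  reach₁⇔adj : ∀ {x y} → x ≢ y → reach G 1 x y ≡ true ⇔ adj G x y ≡ true
  reach₁⇔adj {x} {y} x≢y rewrite dec-false (x ≟ᶠ y) x≢y = mk⇔ step⇒adj adj⇒step
    where
    step : Fin n → Bool
    step z = adj G x z Bool.∧ does (z ≟ᶠ y)

    T-step⇒adj : ∀ z → T (step z) → adj G x y ≡ true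
    T-step⇒adj z t with z ≟ᶠ y
    ... | yes refl = Equivalence.to T-≡ (proj₁ (Equivalence.to T-∧ t))
    ... | no  _    = ⊥-elim (proj₂ (Equivalence.to T-∧ t))

    step⇒adj : any step (allFin n) ≡ true → adj G x y ≡ true
    step⇒adj r =
      T-step⇒adj _ (proj₂ (proj₂ (find (any⁻ step (allFin n) (Equivalence.from T-≡ r)))))

    adj⇒step : adj G x y ≡ true → any step (allFin n) ≡ true
    adj⇒step xy = Equivalence.to T-≡ (any⁺ step (lose (∈-allFin y)
      (Equivalence.from T-∧
        (Equivalence.from T-≡ xy , Equivalence.from T-≡ (dec-true (y ≟ᶠ y) refl)))))

  -- dist tries the distances 0, 1, 2, … with fuel n; 2 ≤ n ensures that 1 is tried.
  dist≡1⇔adj : 2 ≤ n → ∀ {x y} → x ≢ y → dist G x y ≡ 1 ⇔ adj G x y ≡ true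
  dist≡1⇔adj (s≤s (s≤s {n = m} _)) {x} {y} x≢y =
    subst (λ d → d ≡ 1 ⇔ adj G x y ≡ true)
      (sym (distFrom-skip 0 (suc m) {x} {y} (dec-false (x ≟ᶠ y) x≢y)))
      (⇔-trans (distFrom≡⇔reach 1 m {x} {y}) (reach₁⇔adj x≢y))

  reach⇒neighbour : ∀ k {x y} → reach G k x y ≡ true → x ≢ y → ∃ λ z → adj G x z ≡ true
  reach⇒neighbour zero {x} {y} r x≢y = contradiction (trans (sym (dec-false (x ≟ᶠ y) x≢y)) r) λ ()
  reach⇒neighbour (suc k) {x} {y} r x≢y with Equivalence.to T-∨ (Equivalence.from T-≡ r)
  ... | inj₁ r′ = reach⇒neighbour k (Equivalence.to T-≡ r′) x≢y
  ... | inj₂ r′ with find (any⁻ _ (allFin n) r′)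
  ... | z , _ , xz∧zy = z , Equivalence.to T-≡ (proj₁ (Equivalence.to T-∧ xz∧zy))

  Connected⇒neighbour : 2 ≤ n → Connected G → ∀ v → ∃ λ z → adj G v z ≡ true
  Connected⇒neighbour 2≤n conn v =
    let w , w≢v = another 2≤n v
        k , r   = conn v w
    in reach⇒neighbour k r (w≢v ∘ sym)

  equidistant⇒Equiv : ∀ {S x y} → S x ≡ false → S y ≡ false →
                      (∀ t → S t ≡ true → dist G x t ≡ dist G y t) → Equiv G S x y
  equidistant⇒Equiv {S} Sx Sy x≡y = Sx , Sy ,
    ↭-reflexive (map-cong-local (All.tabulate λ {t} t∈ → x≡y t (Equivalence.to (∈-inside {S}) t∈)))

  Equiv⇒distance-match : ∀ {S x y t} → Equiv G S x y → S t ≡ true →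
                         ∃ λ t′ → S t′ ≡ true × dist G x t ≡ dist G y t′
  Equiv⇒distance-match {S} {x} {y} (_ , _ , x↭y) St
    with ∈-map⁻ (dist G y) (∈-resp-↭ x↭y (∈-map⁺ (dist G x) (Equivalence.from (∈-inside {S}) St)))
  ... | t′ , t′∈ , eq = t′ , Equivalence.to (∈-inside {S}) t′∈ , eq

  singleton : Fin n → Subset G
  singleton v z = does (z ≟ᶠ v)

  singleton-true : ∀ {v t} → singleton v t ≡ true → t ≡ v
  singleton-true {v} {t} St with t ≟ᶠ v
  singleton-true St  | yes t≡v = t≡v
  singleton-true ()  | no _

  singleton-false : ∀ {v t} → singleton v t ≡ false → t ≢ v
  singleton-false {v} {t} St t≡v = contradiction (trans (sym St) (dec-true (t ≟ᶠ v) t≡v)) λ ()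

  singleton-Proper : 2 ≤ n → ∀ v → Proper (singleton v)
  singleton-Proper 2≤n v =
    let w , w≢v = another 2≤n v
    in (v , dec-true (v ≟ᶠ v) refl) , (w , dec-false (w ≟ᶠ v) w≢v)

  Dominating : Fin n → Set
  Dominating v = ∀ y → y ≢ v → adj G v y ≡ true

  degree≡n∸1⇔Dominating : ∀ {v} → degree G v ≡ n ∸ 1 ⇔ Dominating v
  degree≡n∸1⇔Dominating {v} =
    ⇔-trans (⇔-sym (suc≡⇔≡∸1 {{nonZeroIndex v}}))
      (⇔-trans (⇔-sym (covers-all-but⇔length (inside-unique (adj G v)) v∉N)) covers⇔Dominating)
    where
    v∉N : v ∉ inside (adj G v)
    v∉N v∈N = contradiction (trans (sym (irrefl G v)) (Equivalence.to (∈-inside {adj G v}) v∈N)) λ ()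

    covers⇔Dominating : (∀ y → y ≢ v → y ∈ inside (adj G v)) ⇔ Dominating v
    covers⇔Dominating = mk⇔ (λ covers y y≢v → Equivalence.to (∈-inside {adj G v}) (covers y y≢v))
                             (λ dom y y≢v → Equivalence.from (∈-inside {adj G v}) (dom y y≢v))

  Dominating⇒IsMARS : 2 ≤ n → ∀ {v} → Dominating v → IsMARS G (singleton v) (n ∸ 1)
  Dominating⇒IsMARS 2≤n {v} dom =
    nonempty , (w , Sw) ,
    (w , Sw , subst (ClassSize G S w) (classSize≡n∸1 Sw) (class-ClassSize S w)) ,
    λ x c Sx x-c →
      ≤-reflexive (trans (sym (classSize≡n∸1 Sx)) (sym (ClassSize⇒≡classSize {S} {x} x-c)))
    where
    S : Subset G
    S = singleton v

    proper : Proper S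
    proper = singleton-Proper 2≤n v

    nonempty : ∃ λ s → S s ≡ true
    nonempty = proj₁ proper

    w : Fin n
    w = proj₁ (proj₂ proper)

    Sw : S w ≡ false
    Sw = proj₂ (proj₂ proper)

    adjacent : ∀ {x} → S x ≡ false → dist G x v ≡ 1
    adjacent {x} Sx = Equivalence.from (dist≡1⇔adj 2≤n (singleton-false Sx))
      (trans (Graph.sym G x v) (dom x (singleton-false Sx)))

    classSize≡n∸1 : ∀ {x} → S x ≡ false → classSize S x ≡ n ∸ 1
    classSize≡n∸1 {x} Sx = Equivalence.to (suc≡⇔≡∸1 {{nonZeroIndex v}})
      (Equivalence.to (covers-all-but⇔length (class-unique S x) v∉class) covers)
      where
      v∉class : v ∉ class S x
      v∉class v∈ = singleton-false {v} (proj₁ (proj₂ (Equivalence.to (∈-class {S} {x}) v∈))) refl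

      covers : ∀ y → y ≢ v → y ∈ class S x
      covers y y≢v = Equivalence.from (∈-class {S} {x}) (equidistant⇒Equiv Sx Sy
        λ t St → subst (λ u → dist G x u ≡ dist G y u) (sym (singleton-true St))
                   (trans (adjacent Sx) (sym (adjacent Sy))))
        where
        Sy : S y ≡ false
        Sy = dec-false (y ≟ᶠ v) y≢v

  IsMARS[n∸1]⇒Dominating : 2 ≤ n → Connected G → ∀ {S} → IsMARS G S (n ∸ 1) → ∃ Dominating
  IsMARS[n∸1]⇒Dominating 2≤n conn {S} ((s , Ss) , _ , (x₀ , _ , (L , L! , ∈L⇔ , |L|≡n∸1)) , _) =
    s , dominating
    where
    others∈L : ∀ y → y ≢ s → y ∈ L
    others∈L = Equivalence.from (covers-all-but⇔length L! (inside∉class Ss ∈L⇔))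
      (Equivalence.from (suc≡⇔≡∸1 {{nonZeroIndex s}}) |L|≡n∸1)

    only-s : ∀ {t} → S t ≡ true → t ≡ s
    only-s {t} St with t ≟ᶠ s
    ... | yes t≡s = t≡s
    ... | no  t≢s = ⊥-elim (inside∉class St ∈L⇔ (others∈L t t≢s))

    equidistant : ∀ y → y ≢ s → dist G x₀ s ≡ dist G y s
    equidistant y y≢s with Equiv⇒distance-match (Equivalence.to (∈L⇔ y) (others∈L y y≢s)) Ss
    ... | t , St , eq = subst (λ u → dist G x₀ s ≡ dist G y u) (only-s St) eq

    z : Fin n
    z = proj₁ (Connected⇒neighbour 2≤n conn s)

    sz : adj G s z ≡ true
    sz = proj₂ (Connected⇒neighbour 2≤n conn s)

    z≢s : z ≢ s
    z≢s z≡s =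
      contradiction (trans (sym (irrefl G s)) (subst (λ u → adj G s u ≡ true) z≡s sz)) λ ()

    x₀-adjacent : dist G x₀ s ≡ 1
    x₀-adjacent = trans (equidistant z z≢s)
      (Equivalence.from (dist≡1⇔adj 2≤n z≢s) (trans (Graph.sym G z s) sz))

    dominating : Dominating s
    dominating y y≢s = trans (Graph.sym G s y)
      (Equivalence.to (dist≡1⇔adj 2≤n y≢s) (trans (sym (equidistant y y≢s)) x₀-adjacent))

proposition5 : (n : ℕ) → 2 ≤ n → (G : Graph n) → Connected G →
    (∃ λ k → IsKappa G k × 1 ≤ k × k ≤ n ∸ 1) ×
    (∀ k → IsKappa G k → (k ≡ n ∸ 1) ⇔ (∃ λ (v : Fin n) → degree G v ≡ n ∸ 1))
proposition5 n 2≤n G conn =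
  let κ , κ-isKappa = κ-exists G (singleton-Proper G 2≤n (fromℕ< 2≤n))
  in (κ , κ-isKappa , IsKappa⇒bounds G κ-isKappa) ,
     λ k k-isKappa → mk⇔ (n∸1⇒full-degree k-isKappa) (full-degree⇒n∸1 k-isKappa)
  where
  n∸1⇒full-degree : ∀ {k} → IsKappa G k → k ≡ n ∸ 1 → ∃ λ v → degree G v ≡ n ∸ 1
  n∸1⇒full-degree ((S , mars) , _) refl =
    let v , dominating = IsMARS[n∸1]⇒Dominating G 2≤n conn mars
    in v , Equivalence.from (degree≡n∸1⇔Dominating G) dominating

  full-degree⇒n∸1 : ∀ {k} → IsKappa G k → (∃ λ v → degree G v ≡ n ∸ 1) → k ≡ n ∸ 1
  full-degree⇒n∸1 ((S , mars) , k-max) (v , degree≡n∸1) =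
    ≤-antisym (IsMARS⇒≤n∸1 G mars)
      (k-max _ _ (Dominating⇒IsMARS G 2≤n (Equivalence.to (degree≡n∸1⇔Dominating G) degree≡n∸1)))
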